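{- Let $N$ be a network based on a connected simple graph $X$ with capacity function $c : EX \to \{1,2,\dots\}$, let $s,t \in VX\cup\Omega X$, and let $f$ be an $(s,t)$-flow. Then for cuts $A$ with $s \in A$ and $t \in A^*$, the value $f^+(A) - f^-(A)$ does not depend on $A$.
   Context: $X$ need not be locally finite. A cut is a subset $A \subseteq VX$, $A\neq\emptyset, VX$, such that the set $\delta A$ of edges with one vertex in $A$ and one in the complement $A^*$ is finite. A ray is a sequence of distinct vertices $x_1,x_2,\dots$ with consecutive ones adjacent; every ray is eventually in $A$ or eventually in $A^*$ for each cut $A$. Two rays are equivalent if no cut has one eventually in $A$ and the other eventually in $A^*$; $\Omega X$ is the set of equivalence classes (ends). For an end $\omega$, "$\omega \in A$" means rays of $\omega$ are eventually in $A$. A cut separates $s,t \in VX\cup\Omega X$ if one of them is in $A$ and the other in $A^*$ in this sense. An $(s,t)$-flow is a map $f : EX \to \{0,1,2,\dots\}$ together with a direction (initial vertex $\iota e$, terminal vertex $\tau e$) for each edge $e$ with $f(e)\neq 0$ such that: (i) each vertex has only finitely many incident edges $e$ with $f(e) \ne 0$; (ii) for every $v\in VX$, $v\neq s,t$, $\sum(f(e) : \iota e = v) = \sum(f(e): \tau e = v)$; (iii) for every cut $A$ not separating $s,t$, $f^+(A) = f^-(A)$, where $f^+(A) = \sum(f(e) : e \in \delta A, \iota e \in A)$ and $f^-(A) = \sum(f(e) : e\in\delta A, \iota e \in A^*)$. -}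

module Defs where

open import Data.Nat using (ℕ; zero; suc; _≤_; _+_)
open import Data.Integer using (ℤ; +_; _-_)
open import Data.Bool using (Bool; true; false; if_then_else_)
open import Data.List using (List; []; _∷_; map)
open import Data.Nat.ListAction using (sum)
open import Data.List.Membership.Propositional using (_∈_)
open import Data.List.Relation.Unary.Unique.Propositional using (Unique)
open import Data.Product using (Σ; ∃; _×_; _,_)
open import Data.Sum using (_⊎_; inj₁; inj₂)
open import Relation.Nullary using (¬_)
open import Relation.Binary.PropositionalEquality using (_≡_; _≢_)

-- Each edge has two distinct endpoints (src, tgt are an arbitrary labelling,
-- not a direction); two edges with the same endpoint set are equal.
record Graph : Set₁ where
  field
    V      : Set
    E      : Set
    src    : E → V
    tgt    : E → V
    noLoop : ∀ e → src e ≢ tgt e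
    simple : ∀ e e′ → ((src e ≡ src e′ × tgt e ≡ tgt e′) ⊎ (src e ≡ tgt e′ × tgt e ≡ src e′)) → e ≡ e′

module _ (G : Graph) where
  open Graph G

  Adjacent : V → V → Set
  Adjacent u v = Σ E λ e → (src e ≡ u × tgt e ≡ v) ⊎ (src e ≡ v × tgt e ≡ u)

  data Walk : V → V → Set where
    [] : ∀ {v} → Walk v v
    _∷_ : ∀ {u v w} → Adjacent u v → Walk v w → Walk u w

  Connected : Set
  Connected = ∀ u v → Walk u v

  FiniteEdges : (E → Set) → Set
  FiniteEdges P = Σ (List E) λ L → Unique L × (∀ e → (P e → e ∈ L) × (e ∈ L → P e))

  -- Subsets of VX are Boolean predicates; complement A* = vertices mapped to false.
  Crosses : (V → Bool) → E → Set
  Crosses A e = ¬ (A (src e) ≡ A (tgt e))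

  record Cut : Set where
    field
      A        : V → Bool
      nonempty : ∃ λ v → A v ≡ true
      nonfull  : ∃ λ v → A v ≡ false
      δ        : FiniteEdges (Crosses A)

  record Ray : Set where
    field
      x        : ℕ → V
      injective : ∀ m n → x m ≡ x n → m ≡ n
      adjacent : ∀ n → Adjacent (x n) (x (suc n))

  -- Elements of VX ∪ ΩX: a vertex, or an end represented by one of its rays.
  -- All predicates below are invariant under equivalence of rays.
  Point : Set
  Point = V ⊎ Ray

  InSide : Point → (V → Bool) → Bool → Set
  InSide (inj₁ v) A b = A v ≡ b
  InSide (inj₂ r) A b = ∃ λ N → ∀ n → N ≤ n → A (Ray.x r n) ≡ b

  _∈ₚ_ : Point → (V → Bool) → Set
  p ∈ₚ A = InSide p A true

  _∈*_ : Point → (V → Bool) → Set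
  p ∈* A = InSide p A false

  Separates : (V → Bool) → Point → Point → Set
  Separates A s t = (s ∈ₚ A × t ∈* A) ⊎ (s ∈* A × t ∈ₚ A)

  ι : (E → Bool) → E → V
  ι dir e = if dir e then src e else tgt e

  τ : (E → Bool) → E → V
  τ dir e = if dir e then tgt e else src e

  fPlus : (E → ℕ) → (E → Bool) → Cut → ℕ
  fPlus f dir C = sum (map (λ e → if Cut.A C (ι dir e) then f e else 0) (Data.Product.proj₁ (Cut.δ C)))

  fMinus : (E → ℕ) → (E → Bool) → Cut → ℕ
  fMinus f dir C = sum (map (λ e → if Cut.A C (ι dir e) then 0 else f e) (Data.Product.proj₁ (Cut.δ C)))

  -- An (s,t)-flow. A direction is given for every edge (it is irrelevant
  -- where f e = 0, since such edges contribute nothing).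
  record Flow (s t : Point) : Set where
    field
      f   : E → ℕ
      dir : E → Bool
      locFin : ∀ v → FiniteEdges (λ e → (src e ≡ v ⊎ tgt e ≡ v) × f e ≢ 0)
      conserve : ∀ v → s ≢ inj₁ v → t ≢ inj₁ v
               → (Lo : FiniteEdges (λ e → ι dir e ≡ v × f e ≢ 0))
               → (Li : FiniteEdges (λ e → τ dir e ≡ v × f e ≢ 0))
               → sum (map f (Data.Product.proj₁ Lo)) ≡ sum (map f (Data.Product.proj₁ Li))
      cutConserve : ∀ (C : Cut) → ¬ Separates (Cut.A C) s t → fPlus f dir C ≡ fMinus f dir C

  value : ∀ {s t} → Flow s t → Cut → ℤ
  value F C = + fPlus (Flow.f F) (Flow.dir F) C - + fMinus (Flow.f F) (Flow.dir F) C

-- Let out(S) be the net flow leaving a vertex set S: a sum of signed edge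
-- contributions over any finite list containing δS. Edgewise,
-- out(A) = out(A ∩ B) + out(A ∖ B). As s ∈ B and t ∉ A, the set A ∖ B does not
-- separate s and t, so out(A ∖ B) = 0: by (iii) if A ∖ B has a crossing edge
-- (then it is a cut), and termwise otherwise. Hence the value of A is out(A ∩ B),
-- and by symmetry so is the value of B.
module Submission where

open import Defs
open import Algebra.Bundles using (CommutativeMonoid)
open import Data.Nat using (ℕ; _≤_; _⊔_)
open import Data.Nat.Properties using (m≤m⊔n; m≤n⊔m)
open import Data.Nat.ListAction using (sum)
open import Data.Integer using (ℤ; +_; _-_; _+_; -_; 0ℤ)
import Data.Integer.Properties as ℤ
open import Data.Integer.Tactic.RingSolver using (solve-∀)
open import Data.Bool using (Bool; true; false; _∧_; not; if_then_else_)
open import Data.Bool.Properties using (∧-comm; ∧-zeroʳ; ¬-not) renaming (_≟_ to _≟ᵇ_)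
open import Data.List using (List; []; _∷_; _++_; map; filter; foldr)
open import Data.List.Properties using (map-cong; map-cong-local)
open import Data.List.Membership.Propositional using (_∈_)
open import Data.List.Membership.Propositional.Properties
  using (∈-filter⁺; ∈-filter⁻; ∈-++⁺ˡ; ∈-++⁺ʳ)
open import Data.List.Membership.Propositional.Properties.WithK using (unique∧set⇒bag)
open import Data.List.Relation.Binary.BagAndSetEquality using (∼bag⇒↭)
open import Data.List.Relation.Binary.Permutation.Propositional using (_↭_; ↭⇒↭ₛ)
import Data.List.Relation.Binary.Permutation.Propositional.Properties as ↭
open import Data.List.Relation.Binary.Permutation.Setoid.Properties using (foldr-commMonoid)
open import Data.List.Relation.Unary.Any using (any?; satisfied)
open import Data.List.Relation.Unary.All as All using (All; []; _∷_)
open import Data.List.Relation.Unary.All.Properties using (¬Any⇒All¬)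
open import Data.List.Relation.Unary.Unique.Propositional using (Unique)
import Data.List.Relation.Unary.Unique.Propositional.Properties as Unique
open import Data.Product using (Σ-syntax; ∃; _×_; _,_; proj₁; proj₂)
open import Data.Sum using (_⊎_; inj₁; inj₂; [_,_])
open import Data.Empty using (⊥-elim)
open import Function using (_∘_; mk⇔)
open import Relation.Nullary using (¬_; yes; no)
open import Relation.Nullary.Decidable using (¬?)
open import Relation.Unary using (Decidable)
open import Relation.Binary.PropositionalEquality
  using (_≡_; _≢_; refl; sym; trans; cong; cong₂; module ≡-Reasoning)

-- outflow (tail ∈ S) (head ∈ S) (flow on the edge)
outflow : Bool → Bool → ℕ → ℤ
outflow true  false n = + n
outflow false true  n = - + n
outflow _     _     _ = 0ℤ

outflow-diagonal : ∀ a n → outflow a a n ≡ 0ℤ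
outflow-diagonal true  n = refl
outflow-diagonal false n = refl

outflow-∧-split : ∀ a b c d n →
  outflow a b n ≡ outflow (a ∧ c) (b ∧ d) n + outflow (a ∧ not c) (b ∧ not d) n
outflow-∧-split true  true  true  true  n = refl
outflow-∧-split true  true  true  false n = sym (ℤ.+-inverseʳ (+ n))
outflow-∧-split true  true  false true  n = sym (ℤ.+-inverseˡ (+ n))
outflow-∧-split true  true  false false n = refl
outflow-∧-split true  false true  d     n = sym (ℤ.+-identityʳ _)
outflow-∧-split true  false false d     n = sym (ℤ.+-identityˡ _)
outflow-∧-split false true  c     true  n = sym (ℤ.+-identityʳ _)
outflow-∧-split false true  c     false n = sym (ℤ.+-identityˡ _)
outflow-∧-split false false c     d     n = refl

outflow-≢ : ∀ a b n → a ≢ b → + (if a then n else 0) - + (if a then 0 else n) ≡ outflow a b n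
outflow-≢ true  true  n a≢b = ⊥-elim (a≢b refl)
outflow-≢ true  false n a≢b = ℤ.+-identityʳ _
outflow-≢ false true  n a≢b = ℤ.+-identityˡ _
outflow-≢ false false n a≢b = ⊥-elim (a≢b refl)

sumℤ : List ℤ → ℤ
sumℤ = foldr _+_ 0ℤ

sumℤ-↭ : ∀ {xs ys} → xs ↭ ys → sumℤ xs ≡ sumℤ ys
sumℤ-↭ p = foldr-commMonoid ℤ+.setoid ℤ+.isCommutativeMonoid (↭⇒↭ₛ p)
  where module ℤ+ = CommutativeMonoid ℤ.+-0-commutativeMonoid

module _ {A : Set} where

  sumℤ-map-+ : ∀ (g h : A → ℤ) xs →
    sumℤ (map (λ x → g x + h x) xs) ≡ sumℤ (map g xs) + sumℤ (map h xs)
  sumℤ-map-+ g h []       = refl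
  sumℤ-map-+ g h (x ∷ xs) = begin
    g x + h x + sumℤ (map (λ x → g x + h x) xs)      ≡⟨ cong (_+_ (g x + h x)) (sumℤ-map-+ g h xs) ⟩
    g x + h x + (sumℤ (map g xs) + sumℤ (map h xs))  ≡⟨ interchange (g x) (h x) _ _ ⟩
    g x + sumℤ (map g xs) + (h x + sumℤ (map h xs))  ∎
    where
    open ≡-Reasoning
    interchange : ∀ (a b c d : ℤ) → a + b + (c + d) ≡ a + c + (b + d)
    interchange = solve-∀

  sumℤ-map-vanishing : ∀ (g : A → ℤ) {xs} → All (λ x → g x ≡ 0ℤ) xs → sumℤ (map g xs) ≡ 0ℤ
  sumℤ-map-vanishing g []         = refl
  sumℤ-map-vanishing g (gx≡0 ∷ zs) = cong₂ _+_ gx≡0 (sumℤ-map-vanishing g zs)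

  sumℤ-map-filter : ∀ (g : A → ℤ) {P : A → Set} (P? : Decidable P) →
    (∀ x → ¬ P x → g x ≡ 0ℤ) → ∀ xs → sumℤ (map g xs) ≡ sumℤ (map g (filter P? xs))
  sumℤ-map-filter g P? vanish [] = refl
  sumℤ-map-filter g P? vanish (x ∷ xs) with P? x
  ... | yes _  = cong (_+_ (g x)) (sumℤ-map-filter g P? vanish xs)
  ... | no ¬px = trans (cong₂ _+_ (vanish x ¬px) (sumℤ-map-filter g P? vanish xs)) (ℤ.+-identityˡ _)

  sum-map-difference : ∀ (φ ψ : A → ℕ) xs →
    + sum (map φ xs) - + sum (map ψ xs) ≡ sumℤ (map (λ x → + φ x - + ψ x) xs)
  sum-map-difference φ ψ []       = refl
  sum-map-difference φ ψ (x ∷ xs) = begin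
    + sum (map φ (x ∷ xs)) - + sum (map ψ (x ∷ xs))          ≡⟨ cong₂ _-_ (ℤ.pos-+ (φ x) _) (ℤ.pos-+ (ψ x) _) ⟩
    (+ φ x + + sum (map φ xs)) - (+ ψ x + + sum (map ψ xs))  ≡⟨ regroup (+ φ x) (+ sum (map φ xs)) (+ ψ x) (+ sum (map ψ xs)) ⟩
    (+ φ x - + ψ x) + (+ sum (map φ xs) - + sum (map ψ xs))  ≡⟨ cong (_+_ (+ φ x - + ψ x)) (sum-map-difference φ ψ xs) ⟩
    (+ φ x - + ψ x) + sumℤ (map (λ x → + φ x - + ψ x) xs)    ∎
    where
    open ≡-Reasoning
    regroup : ∀ (a b c d : ℤ) → (a + b) - (c + d) ≡ (a - c) + (b - d)
    regroup = solve-∀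

  filter-↭ : ∀ {P : A → Set} (P? : Decidable P) {xs ys} → Unique xs → Unique ys →
    (∀ {x} → P x → x ∈ xs) → (∀ {x} → P x → x ∈ ys) → filter P? xs ↭ filter P? ys
  filter-↭ {P} P? {xs} {ys} uxs uys P⊆xs P⊆ys =
    ∼bag⇒↭ (unique∧set⇒bag (Unique.filter⁺ P? uxs) (Unique.filter⁺ P? uys)
      (mk⇔ (transport {xs} P⊆ys) (transport {ys} P⊆xs)))
    where
    transport : ∀ {zs} {ws} {x} → (∀ {x} → P x → x ∈ ws) → x ∈ filter P? zs → x ∈ filter P? ws
    transport {zs} P⊆ws x∈ = let Px = proj₂ (∈-filter⁻ P? {xs = zs} x∈) in ∈-filter⁺ P? (P⊆ws Px) Px

module _ (G : Graph) where
  open Graph G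

  Covers : (V → Bool) → List E → Set
  Covers S L = ∀ {e} → Crosses G S e → e ∈ L

  crosses? : (S : V → Bool) → Decidable (Crosses G S)
  crosses? S e = ¬? (S (src e) ≟ᵇ S (tgt e))

  crosses-combine : ∀ (_⊕_ : Bool → Bool → Bool) S T {e} →
    Crosses G (λ v → S v ⊕ T v) e → Crosses G S e ⊎ Crosses G T e
  crosses-combine _⊕_ S T {e} c with S (src e) ≟ᵇ S (tgt e) | T (src e) ≟ᵇ T (tgt e)
  ... | no ¬p | _     = inj₁ ¬p
  ... | yes _ | no ¬q = inj₂ ¬q
  ... | yes p | yes q = ⊥-elim (c (cong₂ _⊕_ p q))

  crosses⇒inhabited : ∀ S {e} → Crosses G S e → ∀ b → ∃ λ v → S v ≡ b
  crosses⇒inhabited S {e} c b with S (src e) ≟ᵇ b | S (tgt e) ≟ᵇ b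
  ... | yes p | _     = src e , p
  ... | no _  | yes q = tgt e , q
  ... | no p  | no q  = ⊥-elim (c (trans (¬-not p) (sym (¬-not q))))

  joint-cover : ∀ {S T} → FiniteEdges G (Crosses G S) → FiniteEdges G (Crosses G T) →
    Σ[ L ∈ List E ] Unique L × Covers S L × Covers T L
  joint-cover {S} {T} (LS , uS , δS) (LT , uT , δT) = LS ++ LT∖LS , uL , covS , covT
    where
    LT∖LS = filter (¬? ∘ crosses? S) LT
    uL : Unique (LS ++ LT∖LS)
    uL = Unique.++⁺ uS (Unique.filter⁺ _ uT)
      λ (p , q) → proj₂ (∈-filter⁻ (¬? ∘ crosses? S) {xs = LT} q) (proj₂ (δS _) p)
    covS : Covers S (LS ++ LT∖LS)
    covS c = ∈-++⁺ˡ (proj₁ (δS _) c)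
    covT : Covers T (LS ++ LT∖LS)
    covT {e} c with crosses? S e
    ... | yes cS = covS cS
    ... | no ¬cS = ∈-++⁺ʳ LS (∈-filter⁺ (¬? ∘ crosses? S) (proj₁ (δT e) c) ¬cS)

  cut-from-cover : ∀ S → (∃ λ v → S v ≡ true) → (∃ λ v → S v ≡ false) →
    ∀ {L} → Unique L → Covers S L → Cut G
  cut-from-cover S inS outS {L} uL cov = record
    { A        = S
    ; nonempty = inS
    ; nonfull  = outS
    ; δ        = filter (crosses? S) L , Unique.filter⁺ (crosses? S) uL
                 , λ e → (λ c → ∈-filter⁺ (crosses? S) (cov c) c)
                       , (λ p → proj₂ (∈-filter⁻ (crosses? S) {xs = L} p))
    }

  InSide-mono : ∀ p {X S b b′} → InSide G p X b → (∀ {v} → X v ≡ b → S v ≡ b′) → InSide G p S b′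
  InSide-mono (inj₁ v) x∈ X⊆S        = X⊆S x∈
  InSide-mono (inj₂ r) (N , tail) X⊆S = N , λ n N≤n → X⊆S (tail n N≤n)

  InSide-both : ∀ p S → ¬ (_∈ₚ_ G p S × _∈*_ G p S)
  InSide-both (inj₁ v) S (v∈ , v∉) with () ← trans (sym v∈) v∉
  InSide-both (inj₂ r) S ((N₁ , in₁) , (N₂ , in₂))
    with () ← trans (sym (in₁ (N₁ ⊔ N₂) (m≤m⊔n N₁ N₂))) (in₂ (N₁ ⊔ N₂) (m≤n⊔m N₁ N₂))

  ∧-not-nonseparating : ∀ {s t} A B → _∈ₚ_ G s B → _∈*_ G t A →
    ¬ Separates G (λ v → A v ∧ not (B v)) s t
  ∧-not-nonseparating {s} A B s∈B t∉A (inj₁ (s∈ , _)) =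
    InSide-both s _ (s∈ , InSide-mono s s∈B λ {v} eq → trans (cong (λ b → A v ∧ not b) eq) (∧-zeroʳ (A v)))
  ∧-not-nonseparating {t = t} A B s∈B t∉A (inj₂ (_ , t∈)) =
    InSide-both t _ (t∈ , InSide-mono t t∉A λ {v} eq → cong (λ a → a ∧ not (B v)) eq)

module _ {G : Graph} {s t : Point G} (F : Flow G s t) where
  open Graph G
  open Flow F

  edgeOutflow : (V → Bool) → E → ℤ
  edgeOutflow S e = outflow (S (ι G dir e)) (S (τ G dir e)) (f e)

  netOutflow : (V → Bool) → List E → ℤ
  netOutflow S L = sumℤ (map (edgeOutflow S) L)

  edgeOutflow-noncrossing : ∀ S {e} → ¬ Crosses G S e → edgeOutflow S e ≡ 0ℤ
  edgeOutflow-noncrossing S {e} ¬c with S (src e) ≟ᵇ S (tgt e) | dir e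
  ... | no c     | _     = ⊥-elim (¬c c)
  ... | yes same | true  rewrite same = outflow-diagonal (S (tgt e)) (f e)
  ... | yes same | false rewrite same = outflow-diagonal (S (tgt e)) (f e)

  edgeOutflow-crossing : ∀ S {e} → Crosses G S e →
    + (if S (ι G dir e) then f e else 0) - + (if S (ι G dir e) then 0 else f e) ≡ edgeOutflow S e
  edgeOutflow-crossing S {e} c = outflow-≢ _ _ (f e) ends-differ
    where
    ends-differ : S (ι G dir e) ≢ S (τ G dir e)
    ends-differ with dir e
    ... | true  = c
    ... | false = c ∘ sym

  netOutflow-cong : ∀ {S T} → (∀ v → S v ≡ T v) → ∀ L → netOutflow S L ≡ netOutflow T L
  netOutflow-cong S≗T L = cong sumℤ (map-cong (λ e → cong₂ (λ a b → outflow a b (f e)) (S≗T _) (S≗T _)) L)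

  netOutflow-∧-split : ∀ (S T : V → Bool) L →
    netOutflow S L ≡ netOutflow (λ v → S v ∧ T v) L + netOutflow (λ v → S v ∧ not (T v)) L
  netOutflow-∧-split S T L = trans
    (cong sumℤ (map-cong (λ e → outflow-∧-split (S (ι G dir e)) (S (τ G dir e)) (T (ι G dir e)) (T (τ G dir e)) (f e)) L))
    (sumℤ-map-+ (edgeOutflow (λ v → S v ∧ T v)) (edgeOutflow (λ v → S v ∧ not (T v))) L)

  netOutflow-cover-invariant : ∀ S {L M} → Unique L → Unique M → Covers G S L → Covers G S M →
    netOutflow S L ≡ netOutflow S M
  netOutflow-cover-invariant S {L} {M} uL uM covL covM = begin
    netOutflow S L                          ≡⟨ sumℤ-map-filter _ (crosses? G S) (λ _ → edgeOutflow-noncrossing S) L ⟩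
    netOutflow S (filter (crosses? G S) L)  ≡⟨ sumℤ-↭ (↭.map⁺ _ (filter-↭ (crosses? G S) uL uM covL covM)) ⟩
    netOutflow S (filter (crosses? G S) M)  ≡⟨ sumℤ-map-filter _ (crosses? G S) (λ _ → edgeOutflow-noncrossing S) M ⟨
    netOutflow S M                          ∎
    where open ≡-Reasoning

  value≡netOutflow : (C : Cut G) {L : List E} → Unique L → Covers G (Cut.A C) L →
    value G F C ≡ netOutflow (Cut.A C) L
  value≡netOutflow C {L} uL cov = begin
    value G F C                ≡⟨ sum-map-difference _ _ δC ⟩
    sumℤ (map _ δC)            ≡⟨ cong sumℤ (map-cong-local (All.tabulate (edgeOutflow-crossing S ∘ proj₂ (δC-iff _)))) ⟩
    netOutflow S δC            ≡⟨ netOutflow-cover-invariant S uδC uL (proj₁ (δC-iff _)) cov ⟩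
    netOutflow S L             ∎
    where
    open ≡-Reasoning
    S = Cut.A C
    δC = proj₁ (Cut.δ C)
    uδC = proj₁ (proj₂ (Cut.δ C))
    δC-iff = proj₂ (proj₂ (Cut.δ C))

  value-nonseparating : (C : Cut G) → ¬ Separates G (Cut.A C) s t → value G F C ≡ 0ℤ
  value-nonseparating C nsep rewrite cutConserve C nsep = ℤ.+-inverseʳ (+ fMinus G f dir C)

  -- A set without crossing edges in L may be empty, hence need not be a cut.
  netOutflow-nonseparating : ∀ S → (∃ λ v → S v ≡ false) → ¬ Separates G S s t →
    ∀ {L} → Unique L → Covers G S L → netOutflow S L ≡ 0ℤ
  netOutflow-nonseparating S outS nsep {L} uL cov with any? (crosses? G S) L
  ... | yes some = trans (sym (value≡netOutflow C uL cov)) (value-nonseparating C nsep)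
    where C = cut-from-cover G S (crosses⇒inhabited G S (proj₂ (satisfied some)) true) outS uL cov
  ... | no none  = sumℤ-map-vanishing _ (All.map (edgeOutflow-noncrossing S) (¬Any⇒All¬ L none))

  value≡netOutflow-∧ : ∀ (A B : Cut G) → _∈ₚ_ G s (Cut.A B) → _∈*_ G t (Cut.A A) →
    ∀ {L} → Unique L → Covers G (Cut.A A) L → Covers G (Cut.A B) L →
    value G F A ≡ netOutflow (λ v → Cut.A A v ∧ Cut.A B v) L
  value≡netOutflow-∧ CA CB s∈B t∉A {L} uL covA covB = begin
    value G F CA                              ≡⟨ value≡netOutflow CA uL covA ⟩
    netOutflow A L                            ≡⟨ netOutflow-∧-split A B L ⟩
    netOutflow A∧B L + netOutflow A∖B L       ≡⟨ cong (_+_ (netOutflow A∧B L)) A∖B-balanced ⟩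
    netOutflow A∧B L + 0ℤ                     ≡⟨ ℤ.+-identityʳ _ ⟩
    netOutflow A∧B L                          ∎
    where
    open ≡-Reasoning
    A = Cut.A CA
    B = Cut.A CB
    A∧B = λ v → A v ∧ B v
    A∖B = λ v → A v ∧ not (B v)
    A∖B-balanced : netOutflow A∖B L ≡ 0ℤ
    A∖B-balanced = netOutflow-nonseparating A∖B
      (let v , Av≡false = Cut.nonfull CA in v , cong (λ a → a ∧ not (B v)) Av≡false)
      (∧-not-nonseparating G A B s∈B t∉A) uL
      λ c → [ covA , covB ] (crosses-combine G (λ a b → a ∧ not b) A B c)

mainTheorem7 : (G : Graph) → Connected G
    → (c : Graph.E G → ℕ) → (∀ e → 1 ≤ c e)
    → (s t : Point G) → (F : Flow G s t)
    → (A B : Cut G)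
    → _∈ₚ_ G s (Cut.A A) → _∈*_ G t (Cut.A A)
    → _∈ₚ_ G s (Cut.A B) → _∈*_ G t (Cut.A B)
    → value G F A ≡ value G F B
mainTheorem7 G _ _ _ s t F A B s∈A t∉A s∈B t∉B = begin
  value G F A                                      ≡⟨ value≡netOutflow-∧ F A B s∈B t∉A uL covA covB ⟩
  netOutflow F (λ v → Cut.A A v ∧ Cut.A B v) L     ≡⟨ netOutflow-cong F (λ v → ∧-comm (Cut.A A v) (Cut.A B v)) L ⟩
  netOutflow F (λ v → Cut.A B v ∧ Cut.A A v) L     ≡⟨ value≡netOutflow-∧ F B A s∈A t∉B uL covB covA ⟨
  value G F B                                      ∎
  where
  open ≡-Reasoning
  cover = joint-cover G {Cut.A A} {Cut.A B} (Cut.δ A) (Cut.δ B)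
  L = proj₁ cover
  uL = proj₁ (proj₂ cover)
  covA = proj₁ (proj₂ (proj₂ cover))
  covB = proj₂ (proj₂ (proj₂ cover))
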